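{- Let $G=(K,S)$ be a split graph containing no induced tent and no induced $4$-tent, and let $H$ be an induced subgraph of $G$ isomorphic to the co-$4$-tent with $V(H)=\{k_1,k_3,k_5,s_{13},s_{35},s_1,s_5\}$, $k_1,k_3,k_5\in K$, $s_{13},s_{35},s_1,s_5\in S$, where the neighbours in $H$ of $s_{13}$ are $k_1,k_3$, of $s_{35}$ are $k_3,k_5$, of $s_1$ is $k_1$, and of $s_5$ is $k_5$. Let $T_S=\{s_1,s_{13},s_{35},s_5\}$ and define $K_1,\dots,K_8\subseteq K$ as the sets of vertices of $K$ whose set of neighbours in $T_S$ is exactly, respectively: $\{s_1,s_{13}\}$, $\{s_1,s_{13},s_{35}\}$, $\{s_{13},s_{35}\}$, $\{s_{13},s_{35},s_5\}$, $\{s_{35},s_5\}$, $\{s_{35}\}$, $\emptyset$, $\{s_{13}\}$. If $G$ contains no induced subgraph isomorphic to a graph in $\mathcal{T}$ or $\mathcal{F}$, then $\{K_1,\dots,K_8\}$ is a partition of $K$ (some parts possibly empty).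
   Context: A split graph $G=(K,S)$ has vertex set partitioned into a clique $K$ and an independent set $S$. The tent: clique $a,b,c$ and independent $x,y,z$ with $x$ adjacent exactly to $a,b$, $y$ to $b,c$, $z$ to $c,a$. The $4$-tent: clique $a,b,c,d$ and independent $x,y,z$ with $x$ adjacent exactly to $a,b$, $y$ to $b,c$, $z$ to $c,d$. The co-$4$-tent is as described in the claim. For an $n\times m$ $(0,1)$-matrix $M$, $G(M)$ is the split graph with clique $\{k_1,\dots,k_m\}$, independent set $\{s_1,\dots,s_n\}$, $s_ik_j$ an edge iff $M_{ij}=1$. The $k$-sun ($k\ge3$): clique $v_1,\dots,v_k$, independent $w_1,\dots,w_k$, $w_i$ adjacent exactly to $v_i,v_{i+1}$ (mod $k$); an odd $k$-sun with center adds a vertex adjacent exactly to $v_1,\dots,v_k$; tent$\vee K_1$ is the tent plus a vertex adjacent to all its vertices. Matrices: $M_I(k)$ ($k\times k$, $k\ge3$): row $i$ has $1$'s exactly in columns $i,i+1$ (mod $k$). $M_{II}(k)$ ($k\times k$, $k\ge4$): row $1$ is $0$ in column $1$, $1$ elsewhere; rows $2\le j\le k-1$ have $1$'s exactly in columns $j-1,j$; row $k$ is $1$ except in column $k-1$. $M_{III}(k)$ ($k\times(k+1)$, $k\ge3$): rows $1\le j\le k-1$ have $1$'s exactly in columns $j,j+1$; row $k$ has $1$'s exactly in columns $2,\dots,k-1,k+1$. $M_{IV}$: rows $110000,001100,000011,010101$. $M_V$: rows $11000,00110,11110,10011$ (the Tucker matrices). $F_0$: rows $11100,01110,00111$. For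 odd $k\ge5$: $F_1(k)$ ($k\times(k-1)$): row $1$ is $0$ in column $1$, $1$ elsewhere; row $2$ is $1$ except in column $k-1$; rows $3\le j\le k$ have $1$'s exactly in columns $k-j+1,k-j+2$. $F_2(k)$ ($k\times k$): row $1$ has $1$'s exactly in columns $2,\dots,k-1$; rows $2\le j\le k$ have $1$'s exactly in columns $j-1,j$. $\mathcal{T}$: tent$\vee K_1$, all odd $k$-suns with center, and all $G(M)$ with $M$ a Tucker matrix other than $M_I(k)$ for odd $k$ and $M_{III}(k)$ for odd $k\ge5$. $\mathcal{F}$: $G(F_0)$, $G(F_1(k))$, $G(F_2(k))$ for odd $k\ge5$. -}

module Defs where

open import Data.Nat using (ℕ; zero; suc; _+_; _*_; _∸_; _≤_; _≤ᵇ_; _≡ᵇ_)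
open import Data.Nat.Divisibility using (_∣_)
open import Data.Fin using (Fin; zero; suc; toℕ; splitAt; _≟_)
open import Data.Bool using (Bool; true; false; not; _∧_; _∨_; if_then_else_)
open import Data.Sum using (_⊎_; inj₁; inj₂)
open import Data.Product using (_×_; _,_; ∃!)
open import Data.Vec using (Vec; lookup; []; _∷_)
open import Function.Definitions using (Injective)
open import Relation.Nullary using (¬_; does; yes; no)
open import Relation.Nullary.Decidable using (dec-true)
open import Relation.Binary.PropositionalEquality using (_≡_; refl; sym)

record Graph : Set where
  field
    n         : ℕ
    adj       : Fin n → Fin n → Bool
    adj-sym   : ∀ u v → adj u v ≡ adj v u
    adj-irref : ∀ v → adj v v ≡ false
open Graph public

V : Graph → Set
V G = Fin (n G)

record _⊑ᵢ_ (H G : Graph) : Set where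
  field
    emb     : V H → V G
    emb-inj : Injective _≡_ _≡_ emb
    emb-adj : ∀ u v → adj G (emb u) (emb v) ≡ adj H u v

-- Split graphs G = (K , S): inK v ≡ true means v ∈ K, inK v ≡ false means
-- v ∈ S.  K is a clique and S is an independent set.

record IsSplit (G : Graph) (inK : V G → Bool) : Set where
  field
    K-clique : ∀ u v → inK u ≡ true → inK v ≡ true → ¬ u ≡ v → adj G u v ≡ true
    S-indep  : ∀ u v → inK u ≡ false → inK v ≡ false → adj G u v ≡ false

-- The split graph G(M) of an r×c (0,1)-matrix M: independent set
-- s_1..s_r (the first r vertices), clique k_1..k_c (the last c vertices),
-- s_i k_j an edge iff M i j = 1 (true).

Matrix : ℕ → ℕ → Set
Matrix r c = Fin r → Fin c → Bool

private
  adjM : ∀ {r c} → Matrix r c → Fin r ⊎ Fin c → Fin r ⊎ Fin c → Bool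
  adjM M (inj₁ i) (inj₁ i′) = false
  adjM M (inj₁ i) (inj₂ j)  = M i j
  adjM M (inj₂ j) (inj₁ i)  = M i j
  adjM M (inj₂ j) (inj₂ j′) = not (does (j ≟ j′))

  adjM-sym : ∀ {r c} (M : Matrix r c) x y → adjM M x y ≡ adjM M y x
  adjM-sym M (inj₁ i) (inj₁ i′) = refl
  adjM-sym M (inj₁ i) (inj₂ j)  = refl
  adjM-sym M (inj₂ j) (inj₁ i)  = refl
  adjM-sym M (inj₂ j) (inj₂ j′) with j ≟ j′ | j′ ≟ j
  ... | yes _ | yes _ = refl
  ... | no _  | no _  = refl
  ... | yes p | no ¬q = Data.Empty.⊥-elim (¬q (sym p))
    where import Data.Empty
  ... | no ¬p | yes q = Data.Empty.⊥-elim (¬p (sym q))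
    where import Data.Empty

  adjM-irref : ∀ {r c} (M : Matrix r c) x → adjM M x x ≡ false
  adjM-irref M (inj₁ i) = refl
  adjM-irref M (inj₂ j) with j ≟ j
  ... | yes _ = refl
  ... | no ¬p = Data.Empty.⊥-elim (¬p refl)
    where import Data.Empty

GM : ∀ {r c} → Matrix r c → Graph
GM {r} {c} M = record
  { n         = r + c
  ; adj       = λ u v → adjM M (splitAt r u) (splitAt r v)
  ; adj-sym   = λ u v → adjM-sym M (splitAt r u) (splitAt r v)
  ; adj-irref = λ v → adjM-irref M (splitAt r v)
  }

addVertex : (G : Graph) → (V G → Bool) → Graph
addVertex G N = record
  { n         = suc (n G)
  ; adj       = a
  ; adj-sym   = s
  ; adj-irref = ir
  }
  where
  a : Fin (suc (n G)) → Fin (suc (n G)) → Bool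
  a zero    zero    = false
  a zero    (suc j) = N j
  a (suc i) zero    = N i
  a (suc i) (suc j) = adj G i j
  s : ∀ u v → a u v ≡ a v u
  s zero    zero    = refl
  s zero    (suc j) = refl
  s (suc i) zero    = refl
  s (suc i) (suc j) = adj-sym G i j
  ir : ∀ v → a v v ≡ false
  ir zero    = refl
  ir (suc i) = adj-irref G i

-- Matrices.  Indices are written 1-based as in the paper: row i is
-- ι i = toℕ i + 1, column j is ι j.

ι : ∀ {m} → Fin m → ℕ
ι x = suc (toℕ x)

fromRows : ∀ {r c} → Vec (Vec Bool c) r → Matrix r c
fromRows rows i j = lookup (lookup rows i) j

M-I : (k : ℕ) → Matrix k k
M-I k i j = (ι j ≡ᵇ ι i) ∨ (ι j ≡ᵇ suc (ι i)) ∨ ((ι i ≡ᵇ k) ∧ (ι j ≡ᵇ 1))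

M-II : (k : ℕ) → Matrix k k
M-II k i j =
  if ι i ≡ᵇ 1 then not (ι j ≡ᵇ 1)
  else if ι i ≡ᵇ k then not (ι j ≡ᵇ k ∸ 1)
  else (ι j ≡ᵇ ι i ∸ 1) ∨ (ι j ≡ᵇ ι i)

M-III : (k : ℕ) → Matrix k (suc k)
M-III k i j =
  if ι i ≡ᵇ k then ((2 ≤ᵇ ι j) ∧ (ι j ≤ᵇ k ∸ 1)) ∨ (ι j ≡ᵇ suc k)
  else (ι j ≡ᵇ ι i) ∨ (ι j ≡ᵇ suc (ι i))

M-IV : Matrix 4 6
M-IV = fromRows
  ( (true  ∷ true  ∷ false ∷ false ∷ false ∷ false ∷ [])
  ∷ (false ∷ false ∷ true  ∷ true  ∷ false ∷ false ∷ [])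
  ∷ (false ∷ false ∷ false ∷ false ∷ true  ∷ true  ∷ [])
  ∷ (false ∷ true  ∷ false ∷ true  ∷ false ∷ true  ∷ [])
  ∷ [])

M-V : Matrix 4 5
M-V = fromRows
  ( (true  ∷ true  ∷ false ∷ false ∷ false ∷ [])
  ∷ (false ∷ false ∷ true  ∷ true  ∷ false ∷ [])
  ∷ (true  ∷ true  ∷ true  ∷ true  ∷ false ∷ [])
  ∷ (true  ∷ false ∷ false ∷ true  ∷ true  ∷ [])
  ∷ [])

F-0 : Matrix 3 5
F-0 = fromRows
  ( (true  ∷ true  ∷ true  ∷ false ∷ false ∷ [])
  ∷ (false ∷ true  ∷ true  ∷ true  ∷ false ∷ [])
  ∷ (false ∷ false ∷ true  ∷ true  ∷ true  ∷ [])
  ∷ [])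

F-1 : (k : ℕ) → Matrix k (k ∸ 1)
F-1 k i j =
  if ι i ≡ᵇ 1 then not (ι j ≡ᵇ 1)
  else if ι i ≡ᵇ 2 then not (ι j ≡ᵇ k ∸ 1)
  else (ι j ≡ᵇ (k ∸ ι i) + 1) ∨ (ι j ≡ᵇ (k ∸ ι i) + 2)

F-2 : (k : ℕ) → Matrix k k
F-2 k i j =
  if ι i ≡ᵇ 1 then (2 ≤ᵇ ι j) ∧ (ι j ≤ᵇ k ∸ 1)
  else (ι j ≡ᵇ ι i ∸ 1) ∨ (ι j ≡ᵇ ι i)

tent : Graph
tent = GM (M-I 3)

four-tent : Graph
four-tent = GM (fromRows
  ( (true  ∷ true  ∷ false ∷ false ∷ [])
  ∷ (false ∷ true  ∷ true  ∷ false ∷ [])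
  ∷ (false ∷ false ∷ true  ∷ true  ∷ [])
  ∷ []))

tent∨K₁ : Graph
tent∨K₁ = addVertex tent (λ _ → true)

sun : ℕ → Graph
sun k = GM (M-I k)

-- k-sun with center: add a vertex adjacent exactly to v_1..v_k (the clique
-- vertices of G(M_I(k)) are the last k vertices, i.e. splitAt k gives inj₂).
isCliqueVertexOfSun : (k : ℕ) → V (sun k) → Bool
isCliqueVertexOfSun k v with splitAt k {k} v
... | inj₁ _ = false
... | inj₂ _ = true

sunWithCenter : ℕ → Graph
sunWithCenter k = addVertex (sun k) (isCliqueVertexOfSun k)

Odd : ℕ → Set
Odd k = ¬ (2 ∣ k)

Even : ℕ → Set
Even k = 2 ∣ k

data 𝒯 : Graph → Set where
  T-tent∨K₁ : 𝒯 tent∨K₁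
  T-sunC    : ∀ k → 3 ≤ k → Odd k → 𝒯 (sunWithCenter k)
  -- Tucker matrices, excluding M_I(k) for odd k and M_III(k) for odd k ≥ 5
  T-MI      : ∀ k → 3 ≤ k → Even k → 𝒯 (GM (M-I k))
  T-MII     : ∀ k → 4 ≤ k → 𝒯 (GM (M-II k))
  T-MIII-3  : 𝒯 (GM (M-III 3))
  T-MIII    : ∀ k → 3 ≤ k → Even k → 𝒯 (GM (M-III k))
  T-MIV     : 𝒯 (GM M-IV)
  T-MV      : 𝒯 (GM M-V)

data ℱ : Graph → Set where
  F-F0 : ℱ (GM F-0)
  F-F1 : ∀ k → 5 ≤ k → Odd k → ℱ (GM (F-1 k))
  F-F2 : ∀ k → 5 ≤ k → Odd k → ℱ (GM (F-2 k))

-- The co-4-tent configuration H = {k1,k3,k5,s13,s35,s1,s5} as an induced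
-- subgraph of the split graph (G, inK), with the prescribed neighbourhoods.
-- (K is a clique and S independent, so the only remaining data are the
-- adjacencies between the s's and the k's.)

record Co4TentAt (G : Graph) (inK : V G → Bool)
                 (k₁ k₃ k₅ s₁₃ s₃₅ s₁ s₅ : V G) : Set where
  field
    k₁∈K : inK k₁ ≡ true
    k₃∈K : inK k₃ ≡ true
    k₅∈K : inK k₅ ≡ true
    s₁₃∈S : inK s₁₃ ≡ false
    s₃₅∈S : inK s₃₅ ≡ false
    s₁∈S  : inK s₁ ≡ false
    s₅∈S  : inK s₅ ≡ false
    k₁≢k₃ : ¬ k₁ ≡ k₃
    k₁≢k₅ : ¬ k₁ ≡ k₅
    k₃≢k₅ : ¬ k₃ ≡ k₅
    s₁₃k₁ : adj G s₁₃ k₁ ≡ true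
    s₁₃k₃ : adj G s₁₃ k₃ ≡ true
    s₁₃k₅ : adj G s₁₃ k₅ ≡ false
    s₃₅k₁ : adj G s₃₅ k₁ ≡ false
    s₃₅k₃ : adj G s₃₅ k₃ ≡ true
    s₃₅k₅ : adj G s₃₅ k₅ ≡ true
    s₁k₁ : adj G s₁ k₁ ≡ true
    s₁k₃ : adj G s₁ k₃ ≡ false
    s₁k₅ : adj G s₁ k₅ ≡ false
    s₅k₁ : adj G s₅ k₁ ≡ false
    s₅k₃ : adj G s₅ k₃ ≡ false
    s₅k₅ : adj G s₅ k₅ ≡ true

-- Neighbourhood of v in T_S = {s1,s13,s35,s5}, recorded as the tuple
-- (v~s1 , v~s13 , v~s35 , v~s5).
Profile : Set
Profile = Bool × Bool × Bool × Bool

profile : (G : Graph) → (s₁ s₁₃ s₃₅ s₅ : V G) → V G → Profile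
profile G s₁ s₁₃ s₃₅ s₅ v = adj G v s₁ , adj G v s₁₃ , adj G v s₃₅ , adj G v s₅

-- Prescribed neighbourhoods in T_S of K_1, ..., K_8 (index 0..7 here).
partProfile : Fin 8 → Profile
partProfile zero                                         = true  , true  , false , false
partProfile (suc zero)                                   = true  , true  , true  , false
partProfile (suc (suc zero))                             = false , true  , true  , false
partProfile (suc (suc (suc zero)))                       = false , true  , true  , true
partProfile (suc (suc (suc (suc zero))))                 = false , false , true  , true
partProfile (suc (suc (suc (suc (suc zero)))))           = false , false , true  , false
partProfile (suc (suc (suc (suc (suc (suc zero))))))     = false , false , false , false
partProfile (suc (suc (suc (suc (suc (suc (suc zero))))))) = false , true , false , false

Kpart : (G : Graph) (inK : V G → Bool) (s₁ s₁₃ s₃₅ s₅ : V G) → Fin 8 → V G → Set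
Kpart G inK s₁ s₁₃ s₃₅ s₅ i v =
  inK v ≡ true × profile G s₁ s₁₃ s₃₅ s₅ v ≡ partProfile i

IsPartitionOfK : (G : Graph) (inK : V G → Bool) → (Fin 8 → V G → Set) → Set
IsPartitionOfK G inK P =
  (∀ i v → P i v → inK v ≡ true) ×
  (∀ v → inK v ≡ true → ∃! _≡_ (λ i → P i v))

-- Every vertex v of K sees the four vertices s₁, s₁₃, s₃₅, s₅ in one of sixteen
-- patterns.  Adjoining v as a fourth column to the biadjacency matrix of the
-- co-4-tent, each of the eight patterns not listed among K₁ … K₈ contains, as a
-- submatrix, the matrix of a tent, a 4-tent, the 4-sun G(M_I(4)) or G(M_II(4)).
-- A submatrix with distinct rows and columns realised by S- and K-vertices of a
-- split graph is an induced subgraph, so these patterns cannot occur.  The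
-- remaining eight patterns are pairwise distinct, whence the partition.
module Submission where

open import Defs
open import Data.Bool using (Bool; true; false)
import Data.Bool.Properties as Bool
open import Data.Nat.Divisibility using (divides)
open import Data.Nat.Properties using (n≤1+n; ≤-refl)
open import Data.Fin using (Fin; splitAt; join; _≟_)
open import Data.Fin.Patterns using (0F; 1F; 2F; 3F; 4F; 5F; 6F; 7F)
open import Data.Fin.Properties using (all?; join-splitAt)
open import Data.Vec using (lookup; []; _∷_)
open import Data.Sum using (_⊎_; inj₁; inj₂; [_,_]′)
open import Data.Product using (_,_; proj₁; ∃-syntax)
import Data.Product.Properties as Product
open import Data.Empty using (⊥-elim)
open import Relation.Nullary using (¬_; Dec; yes; no)
open import Relation.Nullary.Decidable using (True; toWitness; _→-dec_)
open import Relation.Binary.PropositionalEquality using (_≡_; refl; sym; trans; cong)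
open import Function.Definitions using (Injective)

DistinctColumns : ∀ {r c} → Matrix r c → Set
DistinctColumns {c = c} M = ∀ (j j′ : Fin c) → (∀ i → M i j ≡ M i j′) → j ≡ j′

DistinctRows : ∀ {r c} → Matrix r c → Set
DistinctRows M = DistinctColumns (λ j i → M i j)

distinctColumns? : ∀ {r c} (M : Matrix r c) → Dec (DistinctColumns M)
distinctColumns? M =
  all? λ j → all? λ j′ → all? (λ i → M i j Bool.≟ M i j′) →-dec (j ≟ j′)

distinctRows? : ∀ {r c} (M : Matrix r c) → Dec (DistinctRows M)
distinctRows? M = distinctColumns? (λ j i → M i j)

-- The row and column selections need not be injective; they are whenever M
-- has distinct rows and columns.
record _≼_ {r c r′ c′} (M : Matrix r c) (N : Matrix r′ c′) : Set where
  field
    rows    : Fin r → Fin r′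
    cols    : Fin c → Fin c′
    entries : ∀ i j → N (rows i) (cols j) ≡ M i j

select : ∀ {r c r′ c′} {M : Matrix r c} {N : Matrix r′ c′}
         (ρ : Fin r → Fin r′) (γ : Fin c → Fin c′) →
         {True (all? λ i → all? λ j → N (ρ i) (γ j) Bool.≟ M i j)} → M ≼ N
select ρ γ {ok} = record { rows = ρ ; cols = γ ; entries = toWitness ok }

record Realisation (G : Graph) (inK : V G → Bool) {r c} (M : Matrix r c) : Set where
  field
    row         : Fin r → V G
    col         : Fin c → V G
    row∈S       : ∀ i → inK (row i) ≡ false
    col∈K       : ∀ j → inK (col j) ≡ true
    adj-row-col : ∀ i j → adj G (row i) (col j) ≡ M i j

module _ {G : Graph} {inK : V G → Bool} where

  restrict : ∀ {r c r′ c′} {M : Matrix r c} {N : Matrix r′ c′} →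
             Realisation G inK N → M ≼ N → Realisation G inK M
  restrict R M≼N = record
    { row         = λ i → row (rows i)
    ; col         = λ j → col (cols j)
    ; row∈S       = λ i → row∈S (rows i)
    ; col∈K       = λ j → col∈K (cols j)
    ; adj-row-col = λ i j → trans (adj-row-col (rows i) (cols j)) (entries i j)
    }
    where open Realisation R
          open _≼_ M≼N

  realisation⇒⊑ᵢ : ∀ {r c} {M : Matrix r c} → IsSplit G inK →
                   DistinctRows M → DistinctColumns M → Realisation G inK M → GM M ⊑ᵢ G
  realisation⇒⊑ᵢ {r} {c} {M} split distinctRows distinctCols R = record
    { emb = embed ; emb-inj = embed-injective ; emb-adj = embed-adj }
    where
    open IsSplit split
    open Realisation R

    row-injective : ∀ i i′ → row i ≡ row i′ → i ≡ i′
    row-injective i i′ eq = distinctRows i i′ λ j →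
      trans (sym (adj-row-col i j)) (trans (cong (λ x → adj G x (col j)) eq) (adj-row-col i′ j))

    col-injective : ∀ j j′ → col j ≡ col j′ → j ≡ j′
    col-injective j j′ eq = distinctCols j j′ λ i →
      trans (sym (adj-row-col i j)) (trans (cong (adj G (row i)) eq) (adj-row-col i j′))

    row≢col : ∀ i j → ¬ row i ≡ col j
    row≢col i j eq with trans (sym (row∈S i)) (trans (cong inK eq) (col∈K j))
    ... | ()

    vertex : Fin r ⊎ Fin c → V G
    vertex = [ row , col ]′

    vertex-injective : ∀ x y → vertex x ≡ vertex y → x ≡ y
    vertex-injective (inj₁ i) (inj₁ i′) eq = cong inj₁ (row-injective i i′ eq)
    vertex-injective (inj₁ i) (inj₂ j)  eq = ⊥-elim (row≢col i j eq)
    vertex-injective (inj₂ j) (inj₁ i)  eq = ⊥-elim (row≢col i j (sym eq))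
    vertex-injective (inj₂ j) (inj₂ j′) eq = cong inj₂ (col-injective j j′ eq)

    embed : V (GM M) → V G
    embed u = vertex (splitAt r u)

    embed-injective : Injective _≡_ _≡_ embed
    embed-injective {u} {v} eq =
      trans (sym (join-splitAt r c u))
        (trans (cong (join r c) (vertex-injective (splitAt r u) (splitAt r v) eq))
          (join-splitAt r c v))

    embed-adj : ∀ u v → adj G (embed u) (embed v) ≡ adj (GM M) u v
    embed-adj u v with splitAt r u | splitAt r v
    ... | inj₁ i | inj₁ i′ = S-indep (row i) (row i′) (row∈S i) (row∈S i′)
    ... | inj₁ i | inj₂ j  = adj-row-col i j
    ... | inj₂ j | inj₁ i  = trans (adj-sym G (col j) (row i)) (adj-row-col i j)
    ... | inj₂ j | inj₂ j′ with j ≟ j′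
    ...   | yes refl = adj-irref G (col j)
    ...   | no j≢j′  = K-clique (col j) (col j′) (col∈K j) (col∈K j′) (λ eq → j≢j′ (col-injective j j′ eq))

M-four-tent : Matrix 3 4
M-four-tent = fromRows
  ( (true  ∷ true  ∷ false ∷ false ∷ [])
  ∷ (false ∷ true  ∷ true  ∷ false ∷ [])
  ∷ (false ∷ false ∷ true  ∷ true  ∷ [])
  ∷ [])

-- Rows s₁, s₁₃, s₃₅, s₅ and columns k₁, k₃, k₅, v, where v has the given profile.
coTentWith : Profile → Matrix 4 4
coTentWith (a , b , c , d) = fromRows
  ( (true  ∷ false ∷ false ∷ a ∷ [])
  ∷ (true  ∷ true  ∷ false ∷ b ∷ [])
  ∷ (false ∷ true  ∷ true  ∷ c ∷ [])
  ∷ (false ∷ false ∷ true  ∷ d ∷ [])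
  ∷ [])

data Obstruction (p : Profile) : Set where
  has-tent      : M-I 3 ≼ coTentWith p → Obstruction p
  has-four-tent : M-four-tent ≼ coTentWith p → Obstruction p
  has-four-sun  : M-I 4 ≼ coTentWith p → Obstruction p
  has-M-II₄     : M-II 4 ≼ coTentWith p → Obstruction p

tent-s₁₃s₃₅s₅ : ∀ {a} → M-I 3 ≼ coTentWith (a , true , false , true)
tent-s₁₃s₃₅s₅ = select (lookup (2F ∷ 3F ∷ 1F ∷ [])) (lookup (1F ∷ 2F ∷ 3F ∷ []))

tent-s₁s₁₃s₃₅ : ∀ {d} → M-I 3 ≼ coTentWith (true , false , true , d)
tent-s₁s₁₃s₃₅ = select (lookup (1F ∷ 2F ∷ 0F ∷ [])) (lookup (0F ∷ 1F ∷ 3F ∷ []))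

profile-classification : ∀ p → Obstruction p ⊎ ∃[ i ] p ≡ partProfile i
profile-classification (true  , true  , false , false) = inj₂ (0F , refl)
profile-classification (true  , true  , true  , false) = inj₂ (1F , refl)
profile-classification (false , true  , true  , false) = inj₂ (2F , refl)
profile-classification (false , true  , true  , true ) = inj₂ (3F , refl)
profile-classification (false , false , true  , true ) = inj₂ (4F , refl)
profile-classification (false , false , true  , false) = inj₂ (5F , refl)
profile-classification (false , false , false , false) = inj₂ (6F , refl)
profile-classification (false , true  , false , false) = inj₂ (7F , refl)
profile-classification (true  , false , false , false) = inj₁ (has-four-tent
  (select (lookup (0F ∷ 1F ∷ 2F ∷ [])) (lookup (3F ∷ 0F ∷ 1F ∷ 2F ∷ []))))
profile-classification (false , false , false , true ) = inj₁ (has-four-tent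
  (select (lookup (1F ∷ 2F ∷ 3F ∷ [])) (lookup (0F ∷ 1F ∷ 2F ∷ 3F ∷ []))))
profile-classification (false , true  , false , true ) = inj₁ (has-tent tent-s₁₃s₃₅s₅)
profile-classification (true  , true  , false , true ) = inj₁ (has-tent tent-s₁₃s₃₅s₅)
profile-classification (true  , false , true  , false) = inj₁ (has-tent tent-s₁s₁₃s₃₅)
profile-classification (true  , false , true  , true ) = inj₁ (has-tent tent-s₁s₁₃s₃₅)
profile-classification (true  , false , false , true ) = inj₁ (has-four-sun
  (select (lookup (1F ∷ 2F ∷ 3F ∷ 0F ∷ [])) (lookup (0F ∷ 1F ∷ 2F ∷ 3F ∷ []))))
profile-classification (true  , true  , true  , true ) = inj₁ (has-M-II₄
  (select (lookup (2F ∷ 0F ∷ 3F ∷ 1F ∷ [])) (lookup (0F ∷ 3F ∷ 2F ∷ 1F ∷ []))))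

partProfile-injective : Injective _≡_ _≡_ partProfile
partProfile-injective {i} {j} = toWitness {a? = decided} _ i j
  where
  _≟ₚ_ = Product.≡-dec Bool._≟_ (Product.≡-dec Bool._≟_ (Product.≡-dec Bool._≟_ Bool._≟_))
  decided = all? λ i → all? λ j → (partProfile i ≟ₚ partProfile j) →-dec (i ≟ j)

module _ {G : Graph} {inK : V G → Bool} (split : IsSplit G inK)
         {k₁ k₃ k₅ s₁₃ s₃₅ s₁ s₅ : V G} (H : Co4TentAt G inK k₁ k₃ k₅ s₁₃ s₃₅ s₁ s₅) where

  open Co4TentAt H

  coTentRealisation : ∀ v → inK v ≡ true →
                      Realisation G inK (coTentWith (profile G s₁ s₁₃ s₃₅ s₅ v))
  coTentRealisation v v∈K = record
    { row         = lookup (s₁ ∷ s₁₃ ∷ s₃₅ ∷ s₅ ∷ [])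
    ; col         = lookup (k₁ ∷ k₃ ∷ k₅ ∷ v ∷ [])
    ; row∈S       = λ { 0F → s₁∈S ; 1F → s₁₃∈S ; 2F → s₃₅∈S ; 3F → s₅∈S }
    ; col∈K       = λ { 0F → k₁∈K ; 1F → k₃∈K ; 2F → k₅∈K ; 3F → v∈K }
    ; adj-row-col = λ
        { 0F 0F → s₁k₁  ; 0F 1F → s₁k₃  ; 0F 2F → s₁k₅  ; 0F 3F → adj-sym G s₁ v
        ; 1F 0F → s₁₃k₁ ; 1F 1F → s₁₃k₃ ; 1F 2F → s₁₃k₅ ; 1F 3F → adj-sym G s₁₃ v
        ; 2F 0F → s₃₅k₁ ; 2F 1F → s₃₅k₃ ; 2F 2F → s₃₅k₅ ; 2F 3F → adj-sym G s₃₅ v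
        ; 3F 0F → s₅k₁  ; 3F 1F → s₅k₃  ; 3F 2F → s₅k₅  ; 3F 3F → adj-sym G s₅ v
        }
    }

  submatrix⇒⊑ᵢ : ∀ {v r c} {M : Matrix r c} → inK v ≡ true →
                 M ≼ coTentWith (profile G s₁ s₁₃ s₃₅ s₅ v) →
                 {True (distinctRows? M)} → {True (distinctColumns? M)} → GM M ⊑ᵢ G
  submatrix⇒⊑ᵢ {v} v∈K M≼ {rows} {cols} =
    realisation⇒⊑ᵢ split (toWitness rows) (toWitness cols) (restrict (coTentRealisation v v∈K) M≼)

  K-vertex-profile : ¬ (tent ⊑ᵢ G) → ¬ (four-tent ⊑ᵢ G) → (∀ F → 𝒯 F → ¬ (F ⊑ᵢ G)) →
                     ∀ v → inK v ≡ true → ∃[ i ] profile G s₁ s₁₃ s₃₅ s₅ v ≡ partProfile i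
  K-vertex-profile no-tent no-four-tent no-𝒯 v v∈K
    with profile-classification (profile G s₁ s₁₃ s₃₅ s₅ v)
  ... | inj₂ part               = part
  ... | inj₁ (has-tent M≼)      = ⊥-elim (no-tent (submatrix⇒⊑ᵢ v∈K M≼))
  ... | inj₁ (has-four-tent M≼) = ⊥-elim (no-four-tent (submatrix⇒⊑ᵢ v∈K M≼))
  ... | inj₁ (has-four-sun M≼)  = ⊥-elim (no-𝒯 _ (T-MI 4 (n≤1+n 3) (divides 2 refl)) (submatrix⇒⊑ᵢ v∈K M≼))
  ... | inj₁ (has-M-II₄ M≼)     = ⊥-elim (no-𝒯 _ (T-MII 4 ≤-refl) (submatrix⇒⊑ᵢ v∈K M≼))

mainTheorem5 : (G : Graph) (inK : V G → Bool) → IsSplit G inK →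
    ¬ (tent ⊑ᵢ G) → ¬ (four-tent ⊑ᵢ G) →
    (k₁ k₃ k₅ s₁₃ s₃₅ s₁ s₅ : V G) →
    Co4TentAt G inK k₁ k₃ k₅ s₁₃ s₃₅ s₁ s₅ →
    (∀ H → 𝒯 H → ¬ (H ⊑ᵢ G)) →
    (∀ H → ℱ H → ¬ (H ⊑ᵢ G)) →
    IsPartitionOfK G inK (Kpart G inK s₁ s₁₃ s₃₅ s₅)
mainTheorem5 G inK split no-tent no-four-tent k₁ k₃ k₅ s₁₃ s₃₅ s₁ s₅ H no-𝒯 _ =
  (λ _ _ → proj₁) , λ v v∈K →
    let (i , v∈Kᵢ) = K-vertex-profile split H no-tent no-four-tent no-𝒯 v v∈K
    in i , (v∈K , v∈Kᵢ) , λ (_ , v∈Kⱼ) → partProfile-injective (trans (sym v∈Kᵢ) v∈Kⱼ)
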